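{- The edges of every $1$-perfectly orientable graph with $n$ vertices can be covered by $n$ cliques.
   Context: All graphs are finite and simple. An orientation of a graph $G$ is $1$-perfect if for every vertex $v$, its out-neighborhood is a clique in $G$. A graph is $1$-perfectly orientable if it admits a $1$-perfect orientation. -}

module Defs where

open import Data.Nat using (ℕ)
open import Data.Fin using (Fin)
open import Data.Fin.Subset using (Subset; _∈_)
open import Data.Product using (_×_; Σ; ∃-syntax)
open import Data.Sum using (_⊎_)
open import Relation.Nullary using (¬_)
open import Relation.Binary.PropositionalEquality using (_≡_; _≢_)
open import Relation.Binary.Definitions using (Decidable)
open import Level using (0ℓ)

record Graph (n : ℕ) : Set₁ where
  field
    Adj     : Fin n → Fin n → Set
    irrefl  : ∀ v → ¬ Adj v v
    sym     : ∀ {u v} → Adj u v → Adj v u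
    adj?    : Decidable Adj
open Graph public

record Orientation {n : ℕ} (G : Graph n) : Set₁ where
  field
    Arc       : Fin n → Fin n → Set
    arc-edge  : ∀ {u v} → Arc u v → Adj G u v
    edge-arc  : ∀ {u v} → Adj G u v → Arc u v ⊎ Arc v u
    antisym   : ∀ {u v} → Arc u v → ¬ Arc v u
open Orientation public

IsClique : {n : ℕ} → Graph n → (Fin n → Set) → Set
IsClique G S = ∀ {u w} → S u → S w → u ≢ w → Adj G u w

OutNbhd : {n : ℕ} {G : Graph n} → Orientation G → Fin n → Fin n → Set
OutNbhd D v u = Arc D v u

Is1Perfect : {n : ℕ} {G : Graph n} → Orientation G → Set
Is1Perfect {G = G} D = ∀ v → IsClique G (OutNbhd D v)

OnePerfectlyOrientable : {n : ℕ} → Graph n → Set₁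
OnePerfectlyOrientable G = Σ (Orientation G) Is1Perfect

EdgeCliqueCover : {n : ℕ} → Graph n → (k : ℕ) → (Fin k → Subset _) → Set
EdgeCliqueCover {n} G k C =
  (∀ i → IsClique G (λ v → v ∈ C i)) ×
  (∀ {u v} → Adj G u v → ∃[ i ] (u ∈ C i × v ∈ C i))

-- In a 1-perfect orientation the closed out-neighbourhood N⁺[v] = {v} ∪ N⁺(v) of every
-- vertex is a clique, and an edge uv oriented u → v lies in N⁺[u]; so the n closed
-- out-neighbourhoods cover all edges.
module Submission where

open import Defs
open import Data.Nat using (ℕ)
open import Data.Fin using (Fin; _≟_)
open import Data.Fin.Subset using (Subset; _∈_)
open import Data.Product using (∃-syntax; _×_; _,_)
open import Data.Sum using (_⊎_; inj₁; inj₂)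
open import Data.Bool using (true)
open import Data.Vec using (tabulate)
open import Data.Vec.Properties using (lookup∘tabulate; []=⇒lookup; lookup⇒[]=)
open import Data.Empty using (⊥-elim)
open import Relation.Nullary using (yes; no; does)
open import Relation.Nullary.Decidable using (_⊎-dec_)
open import Level using (Level)
open import Relation.Unary as U using (Pred)
open import Relation.Binary.Definitions using (Decidable)
open import Relation.Binary.PropositionalEquality using (_≡_; refl; trans)
  renaming (sym to ≡-sym)

module _ {n : ℕ} {ℓ : Level} {P : Pred (Fin n) ℓ} (P? : U.Decidable P) where

  fromDec : Subset n
  fromDec = tabulate (λ x → does (P? x))

  ∈-fromDec⁻ : ∀ {x} → x ∈ fromDec → P x
  ∈-fromDec⁻ {x} x∈ with P? x | trans (≡-sym (lookup∘tabulate (λ x → does (P? x)) x)) ([]=⇒lookup x∈)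
  ... | yes Px | _ = Px
  ... | no _   | ()

  ∈-fromDec⁺ : ∀ {x} → P x → x ∈ fromDec
  ∈-fromDec⁺ {x} Px = lookup⇒[]= x fromDec (trans (lookup∘tabulate (λ x → does (P? x)) x) doesP)
    where
    doesP : does (P? x) ≡ true
    doesP with P? x
    ... | yes _  = refl
    ... | no ¬Px = ⊥-elim (¬Px Px)

module _ {n : ℕ} {G : Graph n} (D : Orientation G) where

  arc? : Decidable (Arc D)
  arc? u v with adj? G u v
  ... | no ¬uv = no λ u→v → ¬uv (arc-edge D u→v)
  ... | yes uv with edge-arc D uv
  ...   | inj₁ u→v = yes u→v
  ...   | inj₂ v→u = no λ u→v → antisym D u→v v→u

  ClosedOutNbhd : Fin n → Fin n → Set
  ClosedOutNbhd v u = u ≡ v ⊎ OutNbhd D v u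

  closedOutNbhd? : ∀ v → U.Decidable (ClosedOutNbhd v)
  closedOutNbhd? v u = (u ≟ v) ⊎-dec arc? v u

  closedOutNbhd-isClique : Is1Perfect D → ∀ v → IsClique G (ClosedOutNbhd v)
  closedOutNbhd-isClique perfect v (inj₁ refl) (inj₁ refl) u≢w = ⊥-elim (u≢w refl)
  closedOutNbhd-isClique perfect v (inj₁ refl) (inj₂ v→w)  u≢w = arc-edge D v→w
  closedOutNbhd-isClique perfect v (inj₂ v→u)  (inj₁ refl) u≢w = Graph.sym G (arc-edge D v→u)
  closedOutNbhd-isClique perfect v (inj₂ v→u)  (inj₂ v→w)  u≢w = perfect v v→u v→w u≢w

  edge-⊆-closedOutNbhd : ∀ {u v} → Adj G u v → ∃[ i ] (ClosedOutNbhd i u × ClosedOutNbhd i v)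
  edge-⊆-closedOutNbhd {u} {v} uv with edge-arc D uv
  ... | inj₁ u→v = u , inj₁ refl , inj₂ u→v
  ... | inj₂ v→u = v , inj₂ v→u , inj₁ refl

corollary5 : (n : ℕ) (G : Graph n) → OnePerfectlyOrientable G →
    ∃[ C ] EdgeCliqueCover G n C
corollary5 n G (D , perfect) = C , isClique , covers
  where
  C : Fin n → Subset n
  C v = fromDec (closedOutNbhd? D v)

  isClique : ∀ i → IsClique G (λ v → v ∈ C i)
  isClique i u∈ w∈ = closedOutNbhd-isClique D perfect i
    (∈-fromDec⁻ (closedOutNbhd? D i) u∈) (∈-fromDec⁻ (closedOutNbhd? D i) w∈)

  covers : ∀ {u v} → Adj G u v → ∃[ i ] (u ∈ C i × v ∈ C i)
  covers uv with edge-⊆-closedOutNbhd D uv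
  ... | i , u∈ , v∈ = i , ∈-fromDec⁺ (closedOutNbhd? D i) u∈ , ∈-fromDec⁺ (closedOutNbhd? D i) v∈
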